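{- Let $k$ be a positive integer and let $d$ be sufficiently large in terms of $k$. For $S\subseteq[d]$ let $\lambda_S=2\sum_{j\in[k],\,j\text{ odd}}\binom{|S|}{j}\binom{d-|S|}{k-j}$, and let $\lambda_1=2\binom{d-1}{k-1}$ denote the common value of $\lambda_S$ for $|S|=1$. Then: (i) if $k$ is odd, $\lambda_S\ge\frac32\lambda_1$ for every $S\subseteq[d]$ with $|S|\ge2$; (ii) if $k$ is even, $\lambda_S\ge\frac32\lambda_1$ for every $S\subseteq[d]$ with $2\le|S|\le d-2$, and $\lambda_S=\lambda_1$ for every $S$ with $|S|=d-1$.
   Context: $\lambda_S$ is the eigenvalue of the unnormalized Laplacian of the $k$-distance hypercube $Q_{d,k}$ (vertices $\{0,1\}^d$, adjacency iff Hamming distance exactly $k$) associated with the character $\chi_S(x)=(-1)^{\sum_{i\in S}x_i}$. -}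

module Defs where

open import Data.Nat.Base using (ℕ; zero; suc; _+_; _*_; _∸_; parity)
open import Data.Nat.Combinatorics using (_C_)
open import Data.Parity.Base using (Parity; 0ℙ; 1ℙ)
open import Data.Fin.Subset using (Subset; ∣_∣)

oddTerm : ℕ → ℕ → ℕ → ℕ → ℕ
oddTerm s m k j with parity j
... | 0ℙ = 0
... | 1ℙ = (s C j) * (m C (k ∸ j))

oddSum : ℕ → ℕ → ℕ → ℕ → ℕ
oddSum s m k zero    = 0
oddSum s m k (suc j) = oddTerm s m k (suc j) + oddSum s m k j

lambdaS : (d k : ℕ) → Subset d → ℕ
lambdaS d k S = 2 * oddSum ∣ S ∣ (d ∸ ∣ S ∣) k k

lambda1 : ℕ → ℕ → ℕ
lambda1 d k = 2 * ((d ∸ 1) C (k ∸ 1))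

-- Write A_p(s, m, k) = Σ_{j ≡ p mod 2} C(s, j) C(m, k - j), the number of k-subsets of an
-- (s + m)-set meeting a fixed s-subset in a set of size of parity p; then λ_S = 2 A_1(|S|, d - |S|, k).
-- Moving a point to the s-side gives A_p(s + 1, m, k) = A_p(s, m, k) + A_{1-p}(s, m, k - 1), moving
-- one to the m-side gives A_p(s, m + 1, k) = A_p(s, m, k) + A_p(s, m, k - 1), and A_p + A_{1-p} =
-- C(s + m, ·) by Vandermonde.  Two steps on each side therefore give
-- 2 C(s + m, k - 1) ≤ A_p(s + 2, m + 2, k).  Meanwhile λ_1 / 2 = C(s + m + 3, k - 1) for
-- d = s + m + 4, and once d ≥ 14k consecutive binomials C(n, r + 1) / C(n, r) are at least 13, so
-- C(s + m + 3, k - 1) ≤ (14/13)³ C(s + m, k - 1) < (4/3) C(s + m, k - 1).  The sets with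
-- d - |S| ∈ {0, 1} are handled directly: A_1(s, 0, k) = C(s, k), and A_1(s, 1, k) is C(s, k) for
-- odd k and C(s, k - 1) for even k.

module Submission where

open import Data.Fin.Subset using (Subset; ∣_∣)
open import Data.Fin.Subset.Properties using (∣p∣≤n)
open import Data.Nat.Base
open import Data.Nat.Combinatorics using (_C_; nCk+nC[k+1]≡[n+1]C[k+1])
open import Data.Nat.Properties
open import Algebra.Properties.CommutativeSemigroup +-commutativeSemigroup using (interchange)
open import Data.Nat.Tactic.RingSolver using (solve-∀)
open import Data.Parity.Base using (Parity; 0ℙ; 1ℙ; _⁻¹)
open import Data.Parity.Properties using (suc-homo-⁻¹; ⁻¹-involutive)
open import Data.Product using (Σ; _×_; _,_)
open import Function.Base using (_∘_)
open import Relation.Binary.PropositionalEquality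

open import Defs

choose : ℕ → ℕ → ℕ
choose n       zero    = 1
choose zero    (suc k) = 0
choose (suc n) (suc k) = choose n k + choose n (suc k)

C≡choose : ∀ n k → n C k ≡ choose n k
C≡choose n       zero    = refl
C≡choose zero    (suc k) = refl
C≡choose (suc n) (suc k) =
  trans (sym (nCk+nC[k+1]≡[n+1]C[k+1] n k)) (cong₂ _+_ (C≡choose n k) (C≡choose n (suc k)))

choose-1 : ∀ n → choose n 1 ≡ n
choose-1 zero    = refl
choose-1 (suc n) = cong suc (choose-1 n)

choose-absorption : ∀ n r → suc r * choose (suc n) (suc r) ≡ suc n * choose n r
choose-absorption zero zero = refl
choose-absorption zero (suc r) = *-zeroʳ (suc (suc r))
choose-absorption (suc n) zero =
  trans (+-identityʳ _) (trans (cong suc (choose-1 (suc n))) (sym (*-identityʳ (suc (suc n)))))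
choose-absorption (suc n) (suc r) = begin
  suc (suc r) * (x + y)                             ≡⟨ regroupˡ x y r ⟩
  suc r * x + x + suc (suc r) * y                   ≡⟨ cong₂ (λ u v → u + x + v) (choose-absorption n r)
                                                                                   (choose-absorption n (suc r)) ⟩
  suc n * choose n r + x + suc n * choose n (suc r) ≡⟨ regroupʳ (suc n) (choose n r) (choose n (suc r)) ⟩
  suc (suc n) * x                                   ∎
  where
  open ≡-Reasoning
  x y : ℕ
  x = choose (suc n) (suc r)
  y = choose (suc n) (suc (suc r))
  regroupˡ : ∀ x y r → suc (suc r) * (x + y) ≡ suc r * x + x + suc (suc r) * y
  regroupˡ = solve-∀
  regroupʳ : ∀ a u v → a * u + (u + v) + a * v ≡ suc a * (u + v)
  regroupʳ = solve-∀

choose-ratio : ∀ n r → 14 * suc r ≤ suc n → 13 * choose n r ≤ choose n (suc r)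
choose-ratio n r 14[1+r]≤1+n = *-cancelˡ-≤ (suc r) (+-cancelˡ-≤ (suc r * x) _ _ (begin
  suc r * x + suc r * (13 * x) ≡⟨ collect r x ⟩
  14 * suc r * x               ≤⟨ *-monoˡ-≤ x 14[1+r]≤1+n ⟩
  suc n * x                    ≡⟨ choose-absorption n r ⟨
  suc r * (x + y)              ≡⟨ *-distribˡ-+ (suc r) x y ⟩
  suc r * x + suc r * y        ∎))
  where
  open ≤-Reasoning
  x y : ℕ
  x = choose n r
  y = choose n (suc r)
  collect : ∀ r x → suc r * x + suc r * (13 * x) ≡ 14 * suc r * x
  collect = solve-∀

choose-growth : ∀ n r → 14 * r ≤ suc n → 13 * choose (suc n) r ≤ 14 * choose n r
choose-growth n zero    _       = n≤1+n 13
choose-growth n (suc r) 14r≤1+n = begin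
  13 * (choose n r + choose n (suc r))          ≡⟨ *-distribˡ-+ 13 (choose n r) _ ⟩
  13 * choose n r + 13 * choose n (suc r)       ≤⟨ +-monoˡ-≤ _ (choose-ratio n r 14r≤1+n) ⟩
  choose n (suc r) + 13 * choose n (suc r)      ∎
  where open ≤-Reasoning

-- (14/13)³ < 4/3, in the form 3 · 13³ ≤ 3 · 14³ ≤ 4 · 13³.
choose-growth³ : ∀ n r → 14 * r ≤ suc n → 3 * choose (3 + n) r ≤ 4 * choose n r
choose-growth³ n r 14r≤1+n = *-cancelˡ-≤ 2197 (begin
  2197 * (3 * x₃)  ≡⟨ e₃ x₃ ⟩
  507 * (13 * x₃)  ≤⟨ *-monoʳ-≤ 507 (choose-growth (2 + n) r (≤-trans 14r≤2+n (n≤1+n _))) ⟩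
  507 * (14 * x₂)  ≡⟨ e₂ x₂ ⟩
  546 * (13 * x₂)  ≤⟨ *-monoʳ-≤ 546 (choose-growth (1 + n) r 14r≤2+n) ⟩
  546 * (14 * x₁)  ≡⟨ e₁ x₁ ⟩
  588 * (13 * x₁)  ≤⟨ *-monoʳ-≤ 588 (choose-growth n r 14r≤1+n) ⟩
  588 * (14 * x₀)  ≡⟨ e₀ x₀ ⟩
  8232 * x₀        ≤⟨ *-monoˡ-≤ x₀ (m≤m+n 8232 556) ⟩
  8788 * x₀        ≡⟨ e₄ x₀ ⟩
  2197 * (4 * x₀)  ∎)
  where
  open ≤-Reasoning
  14r≤2+n : 14 * r ≤ 2 + n
  14r≤2+n = ≤-trans 14r≤1+n (n≤1+n _)
  x₀ x₁ x₂ x₃ : ℕ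
  x₀ = choose n r
  x₁ = choose (1 + n) r
  x₂ = choose (2 + n) r
  x₃ = choose (3 + n) r
  e₃ : ∀ x → 2197 * (3 * x) ≡ 507 * (13 * x)
  e₃ = solve-∀
  e₂ : ∀ x → 507 * (14 * x) ≡ 546 * (13 * x)
  e₂ = solve-∀
  e₁ : ∀ x → 546 * (14 * x) ≡ 588 * (13 * x)
  e₁ = solve-∀
  e₀ : ∀ x → 588 * (14 * x) ≡ 8232 * x
  e₀ = solve-∀
  e₄ : ∀ x → 8788 * x ≡ 2197 * (4 * x)
  e₄ = solve-∀

shift : (ℕ → ℕ) → ℕ → ℕ
shift f zero    = 0
shift f (suc k) = f k

conv : (ℕ → ℕ) → (ℕ → ℕ) → ℕ → ℕ
conv f g zero    = f 0 * g 0
conv f g (suc k) = f 0 * g (suc k) + conv (f ∘ suc) g k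

conv-congˡ : ∀ {f f′} g → (∀ j → f j ≡ f′ j) → ∀ k → conv f g k ≡ conv f′ g k
conv-congˡ g f≗f′ zero    = cong (_* g 0) (f≗f′ 0)
conv-congˡ g f≗f′ (suc k) =
  cong₂ _+_ (cong (_* g (suc k)) (f≗f′ 0)) (conv-congˡ g (f≗f′ ∘ suc) k)

conv-congʳ : ∀ f {g g′} → (∀ j → g j ≡ g′ j) → ∀ k → conv f g k ≡ conv f g′ k
conv-congʳ f g≗g′ zero    = cong (f 0 *_) (g≗g′ 0)
conv-congʳ f g≗g′ (suc k) =
  cong₂ _+_ (cong (f 0 *_) (g≗g′ (suc k))) (conv-congʳ (f ∘ suc) g≗g′ k)

conv-distribʳ-+ : ∀ f f′ g k → conv (λ j → f j + f′ j) g k ≡ conv f g k + conv f′ g k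
conv-distribʳ-+ f f′ g zero    = *-distribʳ-+ (g 0) (f 0) (f′ 0)
conv-distribʳ-+ f f′ g (suc k) = trans
  (cong₂ _+_ (*-distribʳ-+ (g (suc k)) (f 0) (f′ 0)) (conv-distribʳ-+ (f ∘ suc) (f′ ∘ suc) g k))
  (interchange (f 0 * g (suc k)) (f′ 0 * g (suc k)) (conv (f ∘ suc) g k) (conv (f′ ∘ suc) g k))

conv-distribˡ-+ : ∀ f g g′ k → conv f (λ j → g j + g′ j) k ≡ conv f g k + conv f g′ k
conv-distribˡ-+ f g g′ zero    = *-distribˡ-+ (f 0) (g 0) (g′ 0)
conv-distribˡ-+ f g g′ (suc k) = trans
  (cong₂ _+_ (*-distribˡ-+ (f 0) (g (suc k)) (g′ (suc k))) (conv-distribˡ-+ (f ∘ suc) g g′ k))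
  (interchange (f 0 * g (suc k)) (f 0 * g′ (suc k)) (conv (f ∘ suc) g k) (conv (f ∘ suc) g′ k))

conv-shiftˡ : ∀ f g k → conv (shift f) g k ≡ shift (conv f g) k
conv-shiftˡ f g zero    = refl
conv-shiftˡ f g (suc k) = refl

conv-shiftʳ : ∀ f g k → conv f (shift g) k ≡ shift (conv f g) k
conv-shiftʳ f g zero          = *-zeroʳ (f 0)
conv-shiftʳ f g (suc zero)    = trans (cong (f 0 * g 0 +_) (*-zeroʳ (f 1))) (+-identityʳ _)
conv-shiftʳ f g (suc (suc k)) = cong (f 0 * g (suc k) +_) (conv-shiftʳ (f ∘ suc) g (suc k))

conv-identityʳ : ∀ f k → conv f (choose 0) k ≡ f k
conv-identityʳ f zero    = *-identityʳ (f 0)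
conv-identityʳ f (suc k) =
  trans (cong (_+ conv (f ∘ suc) (choose 0) k) (*-zeroʳ (f 0))) (conv-identityʳ (f ∘ suc) k)

choose-suc : ∀ n k → choose (suc n) k ≡ choose n k + shift (choose n) k
choose-suc n zero    = refl
choose-suc n (suc k) = +-comm (choose n k) (choose n (suc k))

conv-choose-suc : ∀ f m k →
  conv f (choose (suc m)) k ≡ conv f (choose m) k + shift (conv f (choose m)) k
conv-choose-suc f m k = begin
  conv f (choose (suc m)) k                         ≡⟨ conv-congʳ f (choose-suc m) k ⟩
  conv f (λ j → choose m j + shift (choose m) j) k  ≡⟨ conv-distribˡ-+ f (choose m) _ k ⟩
  conv f (choose m) k + conv f (shift (choose m)) k ≡⟨ cong (conv f (choose m) k +_)
                                                          (conv-shiftʳ f (choose m) k) ⟩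
  conv f (choose m) k + shift (conv f (choose m)) k ∎
  where open ≡-Reasoning

vandermonde : ∀ s m k → conv (choose s) (choose m) k ≡ choose (s + m) k
vandermonde s zero    k =
  trans (conv-identityʳ (choose s) k) (cong (λ n → choose n k) (sym (+-identityʳ s)))
vandermonde s (suc m) k = begin
  conv (choose s) (choose (suc m)) k                                  ≡⟨ conv-choose-suc (choose s) m k ⟩
  conv (choose s) (choose m) k + shift (conv (choose s) (choose m)) k ≡⟨ cong₂ _+_ (vandermonde s m k)
                                                                                 (shift-cong k) ⟩
  choose (s + m) k + shift (choose (s + m)) k                         ≡⟨ choose-suc (s + m) k ⟨
  choose (suc (s + m)) k                                              ≡⟨ cong (λ n → choose n k) (+-suc s m) ⟨
  choose (s + suc m) k                                                ∎
  where
  open ≡-Reasoning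
  shift-cong : ∀ k → shift (conv (choose s) (choose m)) k ≡ shift (choose (s + m)) k
  shift-cong zero    = refl
  shift-cong (suc k) = vandermonde s m k

parity-suc : ∀ n → parity (suc n) ≡ parity n ⁻¹
parity-suc n = trans (sym (⁻¹-involutive (parity (suc n)))) (cong _⁻¹ (suc-homo-⁻¹ n))

parity-pred : ∀ {p} k → parity (suc k) ≡ p → parity k ≡ p ⁻¹
parity-pred k eq = trans (sym (suc-homo-⁻¹ k)) (cong _⁻¹ eq)

restrict : Parity → Parity → ℕ → ℕ
restrict 0ℙ 0ℙ x = x
restrict 0ℙ 1ℙ x = 0
restrict 1ℙ 0ℙ x = 0
restrict 1ℙ 1ℙ x = x

restrict-same : ∀ p x → restrict p p x ≡ x
restrict-same 0ℙ x = refl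
restrict-same 1ℙ x = refl

restrict-opposite : ∀ p x → restrict p (p ⁻¹) x ≡ 0
restrict-opposite 0ℙ x = refl
restrict-opposite 1ℙ x = refl

restrict-+ : ∀ p q x → restrict p q x + restrict (p ⁻¹) q x ≡ x
restrict-+ 0ℙ 0ℙ x = +-identityʳ x
restrict-+ 0ℙ 1ℙ x = refl
restrict-+ 1ℙ 0ℙ x = refl
restrict-+ 1ℙ 1ℙ x = +-identityʳ x

restrict-pascal : ∀ p q x y → restrict p (q ⁻¹) (x + y) ≡ restrict p (q ⁻¹) y + restrict (p ⁻¹) q x
restrict-pascal 0ℙ 0ℙ x y = refl
restrict-pascal 0ℙ 1ℙ x y = +-comm x y
restrict-pascal 1ℙ 0ℙ x y = +-comm x y
restrict-pascal 1ℙ 1ℙ x y = refl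

parityPart : Parity → (ℕ → ℕ) → ℕ → ℕ
parityPart p f j = restrict p (parity j) (f j)

parityPart-+ : ∀ p f j → parityPart p f j + parityPart (p ⁻¹) f j ≡ f j
parityPart-+ p f j = restrict-+ p (parity j) (f j)

parityPart-choose-suc : ∀ p s j →
  parityPart p (choose (suc s)) j ≡ parityPart p (choose s) j + shift (parityPart (p ⁻¹) (choose s)) j
parityPart-choose-suc p s zero    = sym (+-identityʳ _)
parityPart-choose-suc p s (suc j) rewrite parity-suc j =
  restrict-pascal p (parity j) (choose s j) (choose s (suc j))

-- parityCount p s m k is A_p(s, m, k).
parityCount : Parity → ℕ → ℕ → ℕ → ℕ
parityCount p s m = conv (parityPart p (choose s)) (choose m)

parityCount-+ : ∀ p s m k → parityCount p s m k + parityCount (p ⁻¹) s m k ≡ choose (s + m) k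
parityCount-+ p s m k = begin
  parityCount p s m k + parityCount (p ⁻¹) s m k
    ≡⟨ conv-distribʳ-+ (parityPart p (choose s)) (parityPart (p ⁻¹) (choose s)) (choose m) k ⟨
  conv (λ j → parityPart p (choose s) j + parityPart (p ⁻¹) (choose s) j) (choose m) k
    ≡⟨ conv-congˡ (choose m) (parityPart-+ p (choose s)) k ⟩
  conv (choose s) (choose m) k
    ≡⟨ vandermonde s m k ⟩
  choose (s + m) k ∎
  where open ≡-Reasoning

parityCount-sucˡ : ∀ p s m k →
  parityCount p (suc s) m k ≡ parityCount p s m k + shift (parityCount (p ⁻¹) s m) k
parityCount-sucˡ p s m k = begin
  parityCount p (suc s) m k
    ≡⟨ conv-congˡ (choose m) (parityPart-choose-suc p s) k ⟩
  conv (λ j → parityPart p (choose s) j + shift (parityPart (p ⁻¹) (choose s)) j) (choose m) k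
    ≡⟨ conv-distribʳ-+ (parityPart p (choose s)) _ (choose m) k ⟩
  parityCount p s m k + conv (shift (parityPart (p ⁻¹) (choose s))) (choose m) k
    ≡⟨ cong (parityCount p s m k +_) (conv-shiftˡ (parityPart (p ⁻¹) (choose s)) (choose m) k) ⟩
  parityCount p s m k + shift (parityCount (p ⁻¹) s m) k ∎
  where open ≡-Reasoning

parityCount-sucʳ : ∀ p s m k →
  parityCount p s (suc m) k ≡ parityCount p s m k + shift (parityCount p s m) k
parityCount-sucʳ p s = conv-choose-suc (parityPart p (choose s))

parityCount-monoˡ : ∀ p s m k → parityCount p s m k ≤ parityCount p (suc s) m k
parityCount-monoˡ p s m k = ≤-trans (m≤m+n _ _) (≤-reflexive (sym (parityCount-sucˡ p s m k)))

parityCount-monoʳ : ∀ p s m k → parityCount p s m k ≤ parityCount p s (suc m) k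
parityCount-monoʳ p s m k = ≤-trans (m≤m+n _ _) (≤-reflexive (sym (parityCount-sucʳ p s m k)))

parityCount-flip : ∀ p s m k → 2 * parityCount (p ⁻¹) s m k ≤ parityCount p (2 + s) m (suc k)
parityCount-flip p s m k = begin
  2 * B s k                        ≡⟨ cong (B s k +_) (+-identityʳ (B s k)) ⟩
  B s k + B s k                    ≤⟨ +-mono-≤ (m≤n+m (B s k) (A s (suc k)))
                                                (parityCount-monoˡ (p ⁻¹) s m k) ⟩
  A s (suc k) + B s k + B (suc s) k ≡⟨ cong (_+ B (suc s) k) (parityCount-sucˡ p s m (suc k)) ⟨
  A (suc s) (suc k) + B (suc s) k  ≡⟨ parityCount-sucˡ p (suc s) m (suc k) ⟨
  A (2 + s) (suc k)                ∎
  where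
  open ≤-Reasoning
  A B : ℕ → ℕ → ℕ
  A s = parityCount p s m
  B s = parityCount (p ⁻¹) s m

parityCount-double : ∀ p s m k → 2 * choose (s + m) k ≤ parityCount p (2 + s) (2 + m) (suc k)
parityCount-double p s m k = begin
  2 * choose (s + m) k                   ≡⟨ cong (2 *_) (parityCount-+ p s m k) ⟨
  2 * (a + b)                            ≡⟨ regroup a b ⟩
  2 * b + (a + a)                        ≤⟨ +-mono-≤ (parityCount-flip p s m k) (+-mono-≤ a≤Z a≤Z) ⟩
  Z (suc k) + (Z k + Z k)                ≤⟨ +-monoʳ-≤ (Z (suc k)) (+-monoʳ-≤ (Z k) Z≤Y) ⟩
  Z (suc k) + (Z k + Y k)                ≡⟨ +-assoc (Z (suc k)) (Z k) (Y k) ⟨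
  Z (suc k) + Z k + Y k                  ≡⟨ cong (_+ Y k) (parityCount-sucʳ p (2 + s) m (suc k)) ⟨
  Y (suc k) + Y k                        ≡⟨ parityCount-sucʳ p (2 + s) (suc m) (suc k) ⟨
  parityCount p (2 + s) (2 + m) (suc k)  ∎
  where
  open ≤-Reasoning
  a b : ℕ
  a = parityCount p s m k
  b = parityCount (p ⁻¹) s m k
  Z Y : ℕ → ℕ
  Z = parityCount p (2 + s) m
  Y = parityCount p (2 + s) (suc m)
  Z≤Y : Z k ≤ Y k
  Z≤Y = parityCount-monoʳ p (2 + s) m k
  a≤Z : a ≤ Z k
  a≤Z = ≤-trans (parityCount-monoˡ p s m k) (parityCount-monoˡ p (suc s) m k)
  regroup : ∀ a b → 2 * (a + b) ≡ 2 * b + (a + a)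
  regroup = solve-∀

parityPart-match : ∀ p f j → parity j ≡ p → parityPart p f j ≡ f j
parityPart-match p f j refl = restrict-same (parity j) (f j)

parityPart-mismatch : ∀ p f j → parity j ≡ p ⁻¹ → parityPart p f j ≡ 0
parityPart-mismatch p f j eq rewrite eq = restrict-opposite p (f j)

parityCount-zeroʳ : ∀ p s k → parityCount p s 0 k ≡ parityPart p (choose s) k
parityCount-zeroʳ p s = conv-identityʳ (parityPart p (choose s))

parityCount-oneʳ : ∀ p s k →
  parityCount p s 1 (suc k) ≡ parityPart p (choose s) (suc k) + parityPart p (choose s) k
parityCount-oneʳ p s k = trans (parityCount-sucʳ p s 0 (suc k))
  (cong₂ _+_ (parityCount-zeroʳ p s (suc k)) (parityCount-zeroʳ p s k))

parityCount-gap : ∀ {d} p s m k → s + m ≡ d → 2 ≤ s → 2 ≤ m → 14 * suc k ≤ d →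
  3 * choose (d ∸ 1) k ≤ 2 * parityCount p s m (suc k)
parityCount-gap p (suc (suc s)) (suc (suc m)) k refl (s≤s (s≤s _)) (s≤s (s≤s _)) 14[1+k]≤d = begin
  3 * choose (suc s + suc (suc m)) k         ≡⟨ cong (λ n → 3 * choose n k) (shape s m) ⟩
  3 * choose (3 + (s + m)) k                 ≤⟨ choose-growth³ (s + m) k 14k≤1+s+m ⟩
  4 * choose (s + m) k                       ≡⟨ *-assoc 2 2 (choose (s + m) k) ⟩
  2 * (2 * choose (s + m) k)                 ≤⟨ *-monoʳ-≤ 2 (parityCount-double p s m k) ⟩
  2 * parityCount p (2 + s) (2 + m) (suc k)  ∎
  where
  open ≤-Reasoning
  shape : ∀ s m → suc s + suc (suc m) ≡ 3 + (s + m)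
  shape = solve-∀
  split : ∀ k → 14 * suc k ≡ 3 + (11 + 14 * k)
  split = solve-∀
  14k≤1+s+m : 14 * k ≤ suc (s + m)
  14k≤1+s+m = ≤-trans (m≤n+m (14 * k) 11) (+-cancelˡ-≤ 3 _ _
    (≤-trans (≤-reflexive (sym (split k))) (≤-trans 14[1+k]≤d (≤-reflexive (cong suc (shape s m))))))

13*≤⇒3*≤2* : ∀ x y → 13 * x ≤ y → 3 * x ≤ 2 * y
13*≤⇒3*≤2* x y 13x≤y = ≤-trans (*-monoˡ-≤ x (m≤m+n 3 10)) (≤-trans 13x≤y (m≤n*m y 2))

parityCount-1ℙ-gap-oddDegree : ∀ {d} s m k → s + m ≡ d → parity (suc k) ≡ 1ℙ → 2 ≤ s →
  14 * suc k ≤ d → 3 * choose (d ∸ 1) k ≤ 2 * parityCount 1ℙ s m (suc k)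
parityCount-1ℙ-gap-oddDegree (suc s) zero k refl odd _ 14[1+k]≤d
  rewrite +-identityʳ s | parityCount-zeroʳ 1ℙ (suc s) (suc k)
        | parityPart-match 1ℙ (choose (suc s)) (suc k) odd =
  13*≤⇒3*≤2* (choose s k) (choose (suc s) (suc k)) (≤-trans (choose-ratio s k 14[1+k]≤d) (m≤n+m _ _))
parityCount-1ℙ-gap-oddDegree s (suc zero) k refl odd _ 14[1+k]≤d
  rewrite +-comm s 1 | parityCount-oneʳ 1ℙ s k | parityPart-match 1ℙ (choose s) (suc k) odd
        | parityPart-mismatch 1ℙ (choose s) k (parity-pred k odd) | +-identityʳ (choose s (suc k)) =
  13*≤⇒3*≤2* (choose s k) (choose s (suc k)) (choose-ratio s k 14[1+k]≤d)
parityCount-1ℙ-gap-oddDegree s (suc (suc m)) k s+m≡d _ 2≤s =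
  parityCount-gap 1ℙ s (suc (suc m)) k s+m≡d 2≤s (s≤s (s≤s z≤n))

parityCount-1ℙ-oneʳ-evenDegree : ∀ s k → parity (suc k) ≡ 0ℙ → parityCount 1ℙ s 1 (suc k) ≡ choose s k
parityCount-1ℙ-oneʳ-evenDegree s k even
  rewrite parityCount-oneʳ 1ℙ s k | parityPart-mismatch 1ℙ (choose s) (suc k) even =
  parityPart-match 1ℙ (choose s) k (parity-pred k even)

sumUpTo : (ℕ → ℕ) → ℕ → ℕ
sumUpTo h zero    = h 0
sumUpTo h (suc n) = h (suc n) + sumUpTo h n

sumUpTo-cong : ∀ {h h′} → (∀ j → h j ≡ h′ j) → ∀ n → sumUpTo h n ≡ sumUpTo h′ n
sumUpTo-cong h≗h′ zero    = h≗h′ 0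
sumUpTo-cong h≗h′ (suc n) = cong₂ _+_ (h≗h′ (suc n)) (sumUpTo-cong h≗h′ n)

sumUpTo-suc : ∀ h n → sumUpTo h (suc n) ≡ sumUpTo (h ∘ suc) n + h 0
sumUpTo-suc h zero    = refl
sumUpTo-suc h (suc n) =
  trans (cong (h (2 + n) +_) (sumUpTo-suc h n)) (sym (+-assoc (h (2 + n)) _ (h 0)))

sumUpTo≡conv : ∀ f g k → sumUpTo (λ j → f j * g (k ∸ j)) k ≡ conv f g k
sumUpTo≡conv f g zero    = refl
sumUpTo≡conv f g (suc k) = trans (sumUpTo-suc (λ j → f j * g (suc k ∸ j)) k)
  (trans (cong (_+ f 0 * g (suc k)) (sumUpTo≡conv (f ∘ suc) g k)) (+-comm _ (f 0 * g (suc k))))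

oddSum≡sumUpTo : ∀ s m k n → oddSum s m k n ≡ sumUpTo (oddTerm s m k) n
oddSum≡sumUpTo s m k zero    = refl
oddSum≡sumUpTo s m k (suc n) = cong (oddTerm s m k (suc n) +_) (oddSum≡sumUpTo s m k n)

oddTerm≡ : ∀ s m k j → oddTerm s m k j ≡ parityPart 1ℙ (choose s) j * choose m (k ∸ j)
oddTerm≡ s m k j with parity j
... | 0ℙ = refl
... | 1ℙ = cong₂ _*_ (C≡choose s j) (C≡choose m (k ∸ j))

oddSum≡parityCount : ∀ s m k → oddSum s m k k ≡ parityCount 1ℙ s m k
oddSum≡parityCount s m k = begin
  oddSum s m k k                                                 ≡⟨ oddSum≡sumUpTo s m k k ⟩
  sumUpTo (oddTerm s m k) k                                      ≡⟨ sumUpTo-cong (oddTerm≡ s m k) k ⟩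
  sumUpTo (λ j → parityPart 1ℙ (choose s) j * choose m (k ∸ j)) k ≡⟨ sumUpTo≡conv _ (choose m) k ⟩
  parityCount 1ℙ s m k                                           ∎
  where open ≡-Reasoning

lambdaS≡parityCount : ∀ {d} k (S : Subset d) →
  lambdaS d k S ≡ 2 * parityCount 1ℙ ∣ S ∣ (d ∸ ∣ S ∣) k
lambdaS≡parityCount {d} k S = cong (2 *_) (oddSum≡parityCount ∣ S ∣ (d ∸ ∣ S ∣) k)

lambda1≡choose : ∀ d k → lambda1 d (suc k) ≡ 2 * choose (d ∸ 1) k
lambda1≡choose d k = cong (2 *_) (C≡choose (d ∸ 1) k)

lambdaS-gap : ∀ {d} k (S : Subset d) →
  3 * choose (d ∸ 1) k ≤ 2 * parityCount 1ℙ ∣ S ∣ (d ∸ ∣ S ∣) (suc k) →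
  3 * lambda1 d (suc k) ≤ 2 * lambdaS d (suc k) S
lambdaS-gap {d} k S gap = begin
  3 * lambda1 d (suc k)                             ≡⟨ cong (3 *_) (lambda1≡choose d k) ⟩
  3 * (2 * choose (d ∸ 1) k)                        ≡⟨ swap 3 2 (choose (d ∸ 1) k) ⟩
  2 * (3 * choose (d ∸ 1) k)                        ≤⟨ *-monoʳ-≤ 2 gap ⟩
  2 * (2 * parityCount 1ℙ ∣ S ∣ (d ∸ ∣ S ∣) (suc k)) ≡⟨ cong (2 *_) (lambdaS≡parityCount (suc k) S) ⟨
  2 * lambdaS d (suc k) S                           ∎
  where
  open ≤-Reasoning
  swap : ∀ a b c → a * (b * c) ≡ b * (a * c)
  swap = solve-∀

lambdaS-codim1 : ∀ {d} k (S : Subset d) → 1 ≤ d → parity (suc k) ≡ 0ℙ → ∣ S ∣ ≡ d ∸ 1 →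
  lambdaS d (suc k) S ≡ lambda1 d (suc k)
lambdaS-codim1 {suc d} k S (s≤s _) even ∣S∣≡d = begin
  lambdaS (suc d) (suc k) S                        ≡⟨ lambdaS≡parityCount (suc k) S ⟩
  2 * parityCount 1ℙ ∣ S ∣ (suc d ∸ ∣ S ∣) (suc k)  ≡⟨ cong (λ s → A s (suc d ∸ s)) ∣S∣≡d ⟩
  2 * parityCount 1ℙ d (suc d ∸ d) (suc k)         ≡⟨ cong (A d) (m+n∸n≡m 1 d) ⟩
  2 * parityCount 1ℙ d 1 (suc k)                   ≡⟨ cong (2 *_) (parityCount-1ℙ-oneʳ-evenDegree d k even) ⟩
  2 * choose d k                                   ≡⟨ lambda1≡choose (suc d) k ⟨
  lambda1 (suc d) (suc k)                          ∎
  where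
  open ≡-Reasoning
  A : ℕ → ℕ → ℕ
  A s m = 2 * parityCount 1ℙ s m (suc k)

m≤n∸o⇒o≤n∸m : ∀ {m n o} → 1 ≤ m → m ≤ n ∸ o → o ≤ n ∸ m
m≤n∸o⇒o≤n∸m {m} {n} {o} 1≤m m≤n∸o = m+n≤o⇒m≤o∸n o (subst (_≤ n) (+-comm m o) m+o≤n)
  where
  o≤n : o ≤ n
  o≤n = <⇒≤ (m∸n≢0⇒n<m (m<n⇒n≢0 (≤-trans 1≤m m≤n∸o)))
  m+o≤n : m + o ≤ n
  m+o≤n = m≤o∸n⇒m+n≤o m o≤n m≤n∸o

lemma11 : (k : ℕ) → 1 ≤ k →
    Σ ℕ (λ D → (d : ℕ) → D ≤ d →
      (parity k ≡ 1ℙ → (S : Subset d) → 2 ≤ ∣ S ∣ →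
        3 * lambda1 d k ≤ 2 * lambdaS d k S)
      × (parity k ≡ 0ℙ →
          ((S : Subset d) → 2 ≤ ∣ S ∣ → ∣ S ∣ ≤ d ∸ 2 →
            3 * lambda1 d k ≤ 2 * lambdaS d k S)
          × ((S : Subset d) → ∣ S ∣ ≡ d ∸ 1 → lambdaS d k S ≡ lambda1 d k)))
lemma11 (suc k) _ = 14 * suc k , λ d D≤d →
    (λ odd S 2≤s → lambdaS-gap k S (parityCount-1ℙ-gap-oddDegree ∣ S ∣ _ k (split S) odd 2≤s D≤d))
  , λ even →
      (λ S 2≤s s≤d∸2 → lambdaS-gap k S
         (parityCount-gap 1ℙ ∣ S ∣ _ k (split S) 2≤s (m≤n∸o⇒o≤n∸m (≤-trans (s≤s z≤n) 2≤s) s≤d∸2) D≤d))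
    , (λ S → lambdaS-codim1 k S (≤-trans (s≤s z≤n) D≤d) even)
  where
  split : ∀ {d} (S : Subset d) → ∣ S ∣ + (d ∸ ∣ S ∣) ≡ d
  split S = m+[n∸m]≡n (∣p∣≤n S)
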